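{- For any types $A, B$ and any function $f : A \to B$, the type $\mathsf{ish2adjl}\, f$ is a proposition, where \[ \mathsf{ish2adjl}\, f :\equiv \sum_{g : B \to A} \sum_{\eta : gf \sim \mathsf{id}_A} \sum_{\varepsilon : fg \sim \mathsf{id}_B} \sum_{\tau : f[\eta] \sim \varepsilon_f} \sum_{\theta : \eta_g \sim g[\varepsilon]} \big(\tau_g \cdot \mathsf{Coh}\, \varepsilon \sim f\llbracket \theta \rrbracket\big). \]
   Context: Work in homotopy type theory with univalence and function extensionality. For $f : A \to B$, $f[p]$ denotes $\mathsf{ap}_f\, p$ and $f\llbracket \alpha \rrbracket$ the action of $f$ on a 2-path $\alpha$. $f \sim g$ is $\prod_x fx = gx$. For a homotopy $H : f \sim g$: $H_h :\equiv \lambda c.\,H_{hc}$; $k[H] :\equiv \lambda a.\,k[H_a]$; for $\alpha : H \sim H'$, $k\llbracket\alpha\rrbracket :\equiv \lambda a.\, k\llbracket \alpha_a\rrbracket$. $H \cdot H'$ is pointwise path concatenation in diagrammatic order. For $h : X \to Y$, $k : Y \to X$, $H : kh \sim \mathsf{id}_X$, $\mathsf{Coh}\, H : H_{kh} \sim k[h[H]]$ is the homotopy whose component at $x$ is the naturality path $H_{khx} = (kh)[H_x]$ (naturality of $H$ at the path $H_x$, cancelling $H_x$) followed by the functoriality path $(kh)[H_x] = k[h[H_x]]$. A type is a proposition if any two of its elements are equal. -}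

{-# OPTIONS --without-K #-}
module Defs where

open import Level using (Level; _⊔_) renaming (suc to lsuc)
open import Data.Product using (Σ; Σ-syntax; _,_; proj₁)
open import Function.Base using (_∘_; id)
open import Relation.Binary.PropositionalEquality
  using (_≡_; refl; sym; trans; cong)
open import Relation.Binary.PropositionalEquality.Properties
  using (trans-reflʳ; trans-assoc; trans-symʳ; cong-∘)

private variable
  a b c : Level

isProp : Set a → Set a
isProp X = (x y : X) → x ≡ y

isContr : Set a → Set a
isContr X = Σ[ x ∈ X ] ((y : X) → x ≡ y)

fib : {A : Set a} {B : Set b} → (A → B) → B → Set (a ⊔ b)
fib {A = A} f y = Σ[ x ∈ A ] (f x ≡ y)

isEquiv : {A : Set a} {B : Set b} → (A → B) → Set (a ⊔ b)
isEquiv {B = B} f = (y : B) → isContr (fib f y)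

_≃_ : Set a → Set b → Set (a ⊔ b)
A ≃ B = Σ[ f ∈ (A → B) ] isEquiv f

idToEquiv : {A B : Set a} → A ≡ B → A ≃ B
idToEquiv refl = id , λ y → (y , refl) , λ { (x , refl) → refl }

Univalence : (ℓ : Level) → Set (lsuc ℓ)
Univalence ℓ = (A B : Set ℓ) → isEquiv (idToEquiv {A = A} {B = B})

FunExt : (a b : Level) → Set (lsuc (a ⊔ b))
FunExt a b = {A : Set a} {B : A → Set b} {f g : (x : A) → B x} →
             (∀ x → f x ≡ g x) → f ≡ g

_∼_ : {A : Set a} {B : A → Set b} → ((x : A) → B x) → ((x : A) → B x) →
      Set (a ⊔ b)
f ∼ g = ∀ x → f x ≡ g x

ap2 : {A : Set a} {B : Set b} (f : A → B) {x y : A} {p q : x ≡ y} →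
      p ≡ q → cong f p ≡ cong f q
ap2 f α = cong (cong f) α

natural : {X : Set a} (φ : X → X) (H : φ ∼ id) {u v : X} (p : u ≡ v) →
          trans (H u) p ≡ trans (cong φ p) (H v)
natural φ H {u} refl = trans-reflʳ (H u)

cancelʳ : {X : Set a} {x y z : X} {r s : x ≡ y} (q : y ≡ z) →
          trans r q ≡ trans s q → r ≡ s
cancelʳ {r = r} {s = s} refl e =
  trans (sym (trans-reflʳ r)) (trans e (trans-reflʳ s))

Coh : {X : Set a} {Y : Set b} {h : X → Y} {k : Y → X} (H : (k ∘ h) ∼ id) →
      (λ x → H (k (h x))) ∼ (λ x → cong k (cong h (H x)))
Coh {h = h} {k = k} H x =
  trans (cancelʳ (H x) (natural (k ∘ h) H (H x))) (cong-∘ (H x))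

ish2adjl : {A : Set a} {B : Set b} → (A → B) → Set (a ⊔ b)
ish2adjl {A = A} {B = B} f =
  Σ[ g ∈ (B → A) ]
  Σ[ η ∈ ((g ∘ f) ∼ id) ]
  Σ[ ε ∈ ((f ∘ g) ∼ id) ]
  Σ[ τ ∈ ((λ x → cong f (η x)) ∼ (λ x → ε (f x))) ]
  Σ[ θ ∈ ((λ y → η (g y)) ∼ (λ y → cong g (ε y))) ]
  ((λ y → trans (τ (g y)) (Coh {h = g} {k = f} ε y)) ∼ (λ y → ap2 f (θ y)))

{-# OPTIONS --safe #-}
{-# OPTIONS --without-K #-}
-- An inhabitant of ish2adjl f makes f an equivalence, and for an equivalence f
-- the type ish2adjl f is contractible: after reordering it is a tower of
-- dependent products of fibres of f, of ap f and of ap (ap f), each of which is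
-- contractible because ap of an equivalence is again an equivalence.  A type
-- that is contractible as soon as it is inhabited is a proposition.
module Submission where

open import Defs
open import Level using (Level; _⊔_)
open import Data.Product using (Σ; Σ-syntax; _,_; proj₁; proj₂)
open import Function.Base using (_∘_; id)
open import Relation.Binary.PropositionalEquality
  using (_≡_; refl; sym; trans; cong)
open import Relation.Binary.PropositionalEquality.Properties
  using (trans-reflʳ; trans-symˡ)

private variable
  a b c : Level

isContr→isProp : {X : Set a} → isContr X → isProp X
isContr→isProp (x₀ , contract) x y = trans (sym (contract x)) (contract y)

retract-isContr : {X : Set a} {Y : Set b} (r : Y → X) (s : X → Y) →
  (∀ x → r (s x) ≡ x) → isContr Y → isContr X
retract-isContr r s rs (y₀ , contract) =
  r y₀ , λ x → trans (cong r (contract (s x))) (rs x)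

isContr-≡ : {X : Set a} → isContr X → (x y : X) → isContr (x ≡ y)
isContr-≡ (x₀ , contract) x y =
  isContr→isProp (x₀ , contract) x y , λ { refl → trans-symˡ (contract x) }

Σ-isContr : {X : Set a} {P : X → Set b} →
  isContr X → (∀ x → isContr (P x)) → isContr (Σ X P)
Σ-isContr {P = P} (x₀ , contract) P-contr =
  (x₀ , proj₁ (P-contr x₀)) , λ (x , p) → over x (contract x) p
  where
  over : ∀ x → x₀ ≡ x → (p : P x) → (x₀ , proj₁ (P-contr x₀)) ≡ (x , p)
  over .x₀ refl p = cong (x₀ ,_) (proj₂ (P-contr x₀) p)

Π-isContr : (fe : ∀ a b → FunExt a b) {X : Set a} {P : X → Set b} →
  (∀ x → isContr (P x)) → isContr ((x : X) → P x)
Π-isContr fe P-contr =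
  (λ x → proj₁ (P-contr x)) , λ s → fe _ _ (λ x → proj₂ (P-contr x) (s x))

Π-Σ-isContr : (fe : ∀ a b → FunExt a b)
  {X : Set a} {P : X → Set b} {Q : (x : X) → P x → Set c} →
  (∀ x → isContr (Σ (P x) (Q x))) →
  isContr (Σ ((x : X) → P x) (λ s → ∀ x → Q x (s x)))
Π-Σ-isContr fe PQ-contr =
  retract-isContr (λ h → (λ x → proj₁ (h x)) , (λ x → proj₂ (h x)))
                  (λ (s , t) x → s x , t x) (λ _ → refl)
                  (Π-isContr fe PQ-contr)

module _ {A : Set a} {B : Set b} (f : A → B) {y : B} where

  FibPath : fib f y → fib f y → Set (a ⊔ b)
  FibPath (x , p) (x′ , p′) = Σ[ q ∈ x ≡ x′ ] (trans (cong f q) p′ ≡ p)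

  FibPath→≡ : {u v : fib f y} → FibPath u v → u ≡ v
  FibPath→≡ (refl , refl) = refl

  ≡→FibPath : {u v : fib f y} → u ≡ v → FibPath u v
  ≡→FibPath refl = refl , refl

  ≡→FibPath∘FibPath→≡ : {u v : fib f y} (w : FibPath u v) →
    ≡→FibPath (FibPath→≡ w) ≡ w
  ≡→FibPath∘FibPath→≡ (refl , refl) = refl

  isContr-FibPath : isContr (fib f y) → (u v : fib f y) → isContr (FibPath u v)
  isContr-FibPath fib-contr u v =
    retract-isContr ≡→FibPath FibPath→≡ ≡→FibPath∘FibPath→≡
                    (isContr-≡ fib-contr u v)

sym-trans-cancelˡ : {X : Set a} {x y z : X} (t : x ≡ y) (e : y ≡ z) →
  trans (sym t) (trans t e) ≡ e
sym-trans-cancelˡ refl e = refl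

-- The fibre of ap f over q is FibPath f (x , q) (y , refl), up to trans-reflʳ.
cong-isEquiv : {A : Set a} {B : Set b} (f : A → B) → isEquiv f →
  {x y : A} → isEquiv (cong f {x} {y})
cong-isEquiv f f-equiv {x} {y} q =
  retract-isContr
    (λ (p , e) → p , trans (sym (trans-reflʳ (cong f p))) e)
    (λ (p , e) → p , trans (trans-reflʳ (cong f p)) e)
    (λ (p , e) → cong (p ,_) (sym-trans-cancelˡ (trans-reflʳ (cong f p)) e))
    (isContr-FibPath f (f-equiv (f y)) (x , q) (y , refl))

isEquiv→isContr-fibˢ : {A : Set a} {B : Set b} (f : A → B) → isEquiv f →
  (y : B) → isContr (Σ[ x ∈ A ] (y ≡ f x))
isEquiv→isContr-fibˢ f f-equiv y =
  retract-isContr (λ (x , e) → x , sym e) (λ (x , e) → x , sym e)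
                  (λ { (x , refl) → refl }) (f-equiv y)

ish2adjl→isEquiv : {A : Set a} {B : Set b} (f : A → B) → ish2adjl f → isEquiv f
ish2adjl→isEquiv f (g , η , ε , τ , _) y = (g y , ε y) , λ { (x , refl) →
  FibPath→≡ f (η x , trans (trans-reflʳ (cong f (η x))) (τ x)) }

module _ (fe : ∀ a b → FunExt a b) {A : Set a} {B : Set b} (f : A → B) where

  Section : Set (a ⊔ b)
  Section = Σ[ g ∈ (B → A) ] ((f ∘ g) ∼ id)

  CompatibleRetraction : Section → Set (a ⊔ b)
  CompatibleRetraction (g , ε) =
    Σ[ η ∈ ((g ∘ f) ∼ id) ] ((λ x → cong f (η x)) ∼ (λ x → ε (f x)))

  Coherence : (s : Section) → CompatibleRetraction s → Set (a ⊔ b)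
  Coherence (g , ε) (η , τ) =
    Σ[ θ ∈ ((λ y → η (g y)) ∼ (λ y → cong g (ε y))) ]
    ((λ y → trans (τ (g y)) (Coh {h = g} {k = f} ε y)) ∼ (λ y → ap2 f (θ y)))

  module _ (f-equiv : isEquiv f) where

    isContr-Section : isContr Section
    isContr-Section = Π-Σ-isContr fe f-equiv

    isContr-CompatibleRetraction : ∀ s → isContr (CompatibleRetraction s)
    isContr-CompatibleRetraction (g , ε) =
      Π-Σ-isContr fe (λ x → cong-isEquiv f f-equiv (ε (f x)))

    isContr-Coherence : ∀ s r → isContr (Coherence s r)
    isContr-Coherence (g , ε) (η , τ) =
      Π-Σ-isContr fe λ y →
        isEquiv→isContr-fibˢ (ap2 f) (cong-isEquiv (cong f) (cong-isEquiv f f-equiv))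
          (trans (τ (g y)) (Coh {h = g} {k = f} ε y))

    isEquiv→isContr-ish2adjl : isContr (ish2adjl f)
    isEquiv→isContr-ish2adjl =
      retract-isContr
        (λ ((g , ε) , (η , τ) , (θ , coh)) → g , η , ε , τ , θ , coh)
        (λ (g , η , ε , τ , θ , coh) → (g , ε) , (η , τ) , (θ , coh))
        (λ _ → refl)
        (Σ-isContr isContr-Section λ s →
          Σ-isContr (isContr-CompatibleRetraction s) (isContr-Coherence s))

theorem3p8 : (ua : ∀ ℓ → Univalence ℓ) → (fe : ∀ a b → FunExt a b) →
    ∀ {a b : Level} {A : Set a} {B : Set b} (f : A → B) → isProp (ish2adjl f)
theorem3p8 _ fe f x =
  isContr→isProp (isEquiv→isContr-ish2adjl fe f (ish2adjl→isEquiv f x)) x
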